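{- If $t\in\mathsf{no}_v$, then there exist a context $\Gamma$, a type $\sigma$ and a tight derivation in system $\mathcal{V}$ of $\Gamma\vdash^{(0,0,|t|_v)} t:\sigma$.
   Context: Terms are $t,u,r ::= x \mid \lambda x.t \mid t\,u \mid t[x\backslash u]$ over a countably infinite set of variables, where $t[x\backslash u]$ (explicit substitution) binds $x$ in $t$; terms are taken modulo $\alpha$-conversion. CBV normal forms: $\mathsf{vr}_v ::= x \mid \mathsf{vr}_v[x\backslash \mathsf{ne}_v]$; $\mathsf{ne}_v ::= \mathsf{vr}_v\,\mathsf{no}_v \mid \mathsf{ne}_v\,\mathsf{no}_v \mid \mathsf{ne}_v[x\backslash\mathsf{ne}_v]$; $\mathsf{no}_v ::= \lambda x.t \mid \mathsf{vr}_v \mid \mathsf{ne}_v \mid \mathsf{no}_v[x\backslash\mathsf{ne}_v]$. The $v$-size is $|x|_v = 0$, $|\lambda x.t|_v=0$, $|t\,u|_v = |t|_v+|u|_v+1$, $|t[x\backslash u]|_v = |t|_v+|u|_v$. Types. Tight types: $\mathtt{tt} ::= \mathtt{n} \mid \mathtt{vl} \mid \mathtt{vr}$. Types $\sigma,\tau ::= \mathtt{tt}\mid\mathcal{M}\mid\mathcal{M}\to\sigma$, with multitypes $\mathcal{M}=[\sigma_i]_{i\in I}$ finite multisets of types ($[\,]$ empty, $\sqcup$ union). Typing contexts $\Gamma$ map variables to multitypes, $[\,]$ for all but finitely many; $(\Gamma+\Delta)(x)=\Gamma(x)\sqcup\Delta(x)$, extended to finite sums; $\Gamma\setminus\!\!\setminus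 x$ maps $x$ to $[\,]$ and agrees with $\Gamma$ elsewhere. Judgements $\Gamma\vdash^{(m,e,s)} t:\sigma$ carry integer counters. System $\mathcal{V}$ has the rules: (var$_p$) $x:[\mathtt{vr}]\vdash^{(0,0,0)} x:\mathtt{vr}$; (val$_p$) $\emptyset\vdash^{(0,0,0)} x:\mathtt{vl}$; (abs$_p$) $\emptyset\vdash^{(0,0,0)}\lambda x.t:\mathtt{vl}$; (app$_p$) from $\Gamma\vdash^{(m,e,s)} t:\mathtt{tt}_1$ with $\mathtt{tt}_1\in\{\mathtt{vr},\mathtt{n}\}$ and $\Delta\vdash^{(m',e',s')} u:\mathtt{tt}_2$ with $\mathtt{tt}_2\in\{\mathtt{vl},\mathtt{n}\}$, infer $\Gamma+\Delta\vdash^{(m+m',e+e',s+s'+1)} t\,u:\mathtt{n}$; (es$_p$) from $\Gamma\vdash^{(m,e,s)} t:\tau$, $\Delta\vdash^{(m',e',s')} u:\mathtt{n}$ and $\Gamma(x)$ tight, infer $(\Gamma\setminus\!\!\setminus x)+\Delta\vdash^{(m+m',e+e',s+s')} t[x\backslash u]:\tau$; (var$_c$) $x:\mathcal{M}\vdash^{(0,1,0)} x:\mathcal{M}$ for any multitype $\mathcal{M}$; (app$_c$) from $\Gamma\vdash^{(m,e,s)} t:[\mathcal{M}\to\tau]$ and $\Delta\vdash^{(m',e',s')} u:\mathcal{M}$, infer $\Gamma+\Delta\vdash^{(m+m'+1,e+e'-1,s+s')} t\,u:\tau$; (appt$_c$) from $\Gamma\vdash^{(m,e,s)} t:[\mathcal{M}\to\tau]$,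 $\Delta\vdash^{(m',e',s')} u:\mathtt{n}$ and $\mathcal{M}$ tight, infer $\Gamma+\Delta\vdash^{(m+m'+1,e+e'-1,s+s')} t\,u:\tau$; (abs$_c$) from $\Gamma_i\vdash^{(m_i,e_i,s_i)} t:\tau_i$ for each $i\in I$ ($I$ finite, possibly empty), infer $+_{i\in I}(\Gamma_i\setminus\!\!\setminus x)\vdash^{(\sum_i m_i,\,1+\sum_i e_i,\,\sum_i s_i)}\lambda x.t:[\Gamma_i(x)\to\tau_i]_{i\in I}$; (es$_c$) from $\Gamma\vdash^{(m,e,s)} t:\sigma$ and $\Delta\vdash^{(m',e',s')} u:\Gamma(x)$, infer $(\Gamma\setminus\!\!\setminus x)+\Delta\vdash^{(m+m',e+e',s+s')} t[x\backslash u]:\sigma$. A multitype is tight if all its elements are tight types; a context is tight if all its multitypes are tight; a derivation of $\Gamma\vdash^{(m,e,s)} t:\sigma$ is tight if $\Gamma$ is tight and $\sigma$ is a tight type. -}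

module Defs where

open import Data.Nat using (ℕ; zero; suc; _≟_) renaming (_+_ to _+ℕ_)
open import Data.Integer using (ℤ; +_; _+_; _-_; 1ℤ; 0ℤ)
open import Data.List using (List; []; _∷_; _++_)
open import Data.List.Relation.Unary.All using (All)
open import Data.Product using (Σ; _×_)
open import Relation.Binary.PropositionalEquality using (_≡_)
open import Relation.Nullary using (does)
open import Data.Bool using (if_then_else_)

data Tm : Set where
  var : ℕ → Tm
  lam : ℕ → Tm → Tm
  app : Tm → Tm → Tm
  es  : Tm → ℕ → Tm → Tm

mutual
  data VrV : Tm → Set where
    vr-var : ∀ x → VrV (var x)
    vr-es  : ∀ {t u} x → VrV t → NeV u → VrV (es t x u)

  data NeV : Tm → Set where
    ne-vr  : ∀ {t u} → VrV t → NoV u → NeV (app t u)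
    ne-ne  : ∀ {t u} → NeV t → NoV u → NeV (app t u)
    ne-es  : ∀ {t u} x → NeV t → NeV u → NeV (es t x u)

  data NoV : Tm → Set where
    no-lam : ∀ x t → NoV (lam x t)
    no-vr  : ∀ {t} → VrV t → NoV t
    no-ne  : ∀ {t} → NeV t → NoV t
    no-es  : ∀ {t u} x → NoV t → NeV u → NoV (es t x u)

size : Tm → ℕ
size (var x)    = 0
size (lam x t)  = 0
size (app t u)  = suc (size t +ℕ size u)
size (es t x u) = size t +ℕ size u

-- Types; multitypes are represented by lists, considered up to
-- permutation (relation _≈M_ below, applied recursively to types).

data Ty : Set where
  n vl vr : Ty
  mt  : List Ty → Ty
  _⇒_ : List Ty → Ty → Ty

MTy : Set
MTy = List Ty

data TightTy : Ty → Set where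
  t-n  : TightTy n
  t-vl : TightTy vl
  t-vr : TightTy vr

TightM : MTy → Set
TightM M = All TightTy M

mutual
  data _≈T_ : Ty → Ty → Set where
    ≈n   : n ≈T n
    ≈vl  : vl ≈T vl
    ≈vr  : vr ≈T vr
    ≈mt  : ∀ {M N} → M ≈M N → mt M ≈T mt N
    ≈arr : ∀ {M N σ τ} → M ≈M N → σ ≈T τ → (M ⇒ σ) ≈T (N ⇒ τ)

  data _≈M_ : MTy → MTy → Set where
    ≈[] : [] ≈M []
    ≈∷  : ∀ {a b M N₁ N₂} → a ≈T b → M ≈M (N₁ ++ N₂) →
          (a ∷ M) ≈M (N₁ ++ (b ∷ N₂))

Ctx : Set
Ctx = ℕ → MTy

∅ : Ctx
∅ _ = []

_⊕_ : Ctx → Ctx → Ctx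
(Γ ⊕ Δ) y = Γ y ++ Δ y

_∖∖_ : Ctx → ℕ → Ctx
(Γ ∖∖ x) y = if does (y ≟ x) then [] else Γ y

_∶∶_ : ℕ → MTy → Ctx
(x ∶∶ M) y = if does (y ≟ x) then M else []

TightCtx : Ctx → Set
TightCtx Γ = ∀ y → TightM (Γ y)

data VrOrN : Ty → Set where
  von-vr : VrOrN vr
  von-n  : VrOrN n

data VlOrN : Ty → Set where
  vln-vl : VlOrN vl
  vln-n  : VlOrN n

infix 3 _⊢[_,_,_]_∶_

mutual
  data _⊢[_,_,_]_∶_ : Ctx → ℤ → ℤ → ℤ → Tm → Ty → Set where
    var-p : ∀ x → (x ∶∶ (vr ∷ [])) ⊢[ + 0 , + 0 , + 0 ] var x ∶ vr
    val-p : ∀ x → ∅ ⊢[ + 0 , + 0 , + 0 ] var x ∶ vl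
    abs-p : ∀ x t → ∅ ⊢[ + 0 , + 0 , + 0 ] lam x t ∶ vl
    app-p : ∀ {Γ Δ m e s m' e' s' t u tt₁ tt₂} →
            Γ ⊢[ m , e , s ] t ∶ tt₁ → VrOrN tt₁ →
            Δ ⊢[ m' , e' , s' ] u ∶ tt₂ → VlOrN tt₂ →
            (Γ ⊕ Δ) ⊢[ m + m' , e + e' , (s + s') + 1ℤ ] app t u ∶ n
    es-p  : ∀ {Γ Δ m e s m' e' s' t u τ} x →
            Γ ⊢[ m , e , s ] t ∶ τ →
            Δ ⊢[ m' , e' , s' ] u ∶ n →
            TightM (Γ x) →
            ((Γ ∖∖ x) ⊕ Δ) ⊢[ m + m' , e + e' , s + s' ] es t x u ∶ τ
    var-c : ∀ x M → (x ∶∶ M) ⊢[ + 0 , + 1 , + 0 ] var x ∶ mt M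
    app-c : ∀ {Γ Δ m e s m' e' s' t u M M' τ} →
            Γ ⊢[ m , e , s ] t ∶ mt ((M ⇒ τ) ∷ []) →
            Δ ⊢[ m' , e' , s' ] u ∶ mt M' → M ≈M M' →
            (Γ ⊕ Δ) ⊢[ (m + m') + 1ℤ , (e + e') - 1ℤ , s + s' ] app t u ∶ τ
    appt-c : ∀ {Γ Δ m e s m' e' s' t u M τ} →
            Γ ⊢[ m , e , s ] t ∶ mt ((M ⇒ τ) ∷ []) →
            Δ ⊢[ m' , e' , s' ] u ∶ n → TightM M →
            (Γ ⊕ Δ) ⊢[ (m + m') + 1ℤ , (e + e') - 1ℤ , s + s' ] app t u ∶ τ
    abs-c : ∀ {Γ L m e s} x t →
            AbsPrems x t Γ L m e s →
            Γ ⊢[ m , 1ℤ + e , s ] lam x t ∶ mt L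
    es-c  : ∀ {Γ Δ m e s m' e' s' t u σ N} x →
            Γ ⊢[ m , e , s ] t ∶ σ →
            Δ ⊢[ m' , e' , s' ] u ∶ mt N → Γ x ≈M N →
            ((Γ ∖∖ x) ⊕ Δ) ⊢[ m + m' , e + e' , s + s' ] es t x u ∶ σ

  -- the finite family of premises (Γᵢ ⊢ t : τᵢ)_{i∈I} of rule abs_c,
  -- indexed by the summed context +ᵢ(Γᵢ∖∖x), the multitype
  -- [Γᵢ(x) → τᵢ]ᵢ and the summed counters
  data AbsPrems (x : ℕ) (t : Tm) : Ctx → MTy → ℤ → ℤ → ℤ → Set where
    prem-nil  : AbsPrems x t ∅ [] (+ 0) (+ 0) (+ 0)
    prem-cons : ∀ {Γ Δ L m e s m' e' s' τ} →
                Γ ⊢[ m , e , s ] t ∶ τ →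
                AbsPrems x t Δ L m' e' s' →
                AbsPrems x t ((Γ ∖∖ x) ⊕ Δ) ((Γ x ⇒ τ) ∷ L)
                         (m + m') (e + e') (s + s')

-- Each normal form is typed by reading its grammar off the persistent
-- rules: variables get vr (or vl, as arguments), abstractions vl,
-- neutral terms n, and explicit substitutions [x\u] with u neutral are
-- typed by es_p.
module Submission where

open import Defs
open import Data.Bool using (true; false)
open import Data.Integer using (+_)
open import Data.List using ([]; _∷_)
open import Data.List.Relation.Unary.All using ([]; _∷_)
open import Data.List.Relation.Unary.All.Properties using (++⁺)
open import Data.Nat using (_≟_) renaming (_+_ to _+ℕ_)
open import Data.Nat.Properties using (+-comm)
open import Data.Product using (Σ; _×_; _,_)
open import Relation.Binary.PropositionalEquality using (subst)
open import Relation.Nullary using (does)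

∅-tight : TightCtx ∅
∅-tight _ = []

∶∶-tight : ∀ x {M} → TightM M → TightCtx (x ∶∶ M)
∶∶-tight x tM y with does (y ≟ x)
... | true  = tM
... | false = []

⊕-tight : ∀ {Γ Δ} → TightCtx Γ → TightCtx Δ → TightCtx (Γ ⊕ Δ)
⊕-tight tΓ tΔ y = ++⁺ (tΓ y) (tΔ y)

∖∖-tight : ∀ {Γ} x → TightCtx Γ → TightCtx (Γ ∖∖ x)
∖∖-tight x tΓ y with does (y ≟ x)
... | true  = []
... | false = tΓ y

VlOrN⇒TightTy : ∀ {σ} → VlOrN σ → TightTy σ
VlOrN⇒TightTy vln-vl = t-vl
VlOrN⇒TightTy vln-n  = t-n

TightlyTyped : Ty → Tm → Set
TightlyTyped σ t =
  Σ Ctx (λ Γ → TightCtx Γ × Γ ⊢[ + 0 , + 0 , + size t ] t ∶ σ)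

es-tightlyTyped : ∀ {τ t u} x →
  TightlyTyped τ t → TightlyTyped n u → TightlyTyped τ (es t x u)
es-tightlyTyped x (Γ , tΓ , ⊢t) (Δ , tΔ , ⊢u) =
  _ , ⊕-tight (∖∖-tight x tΓ) tΔ , es-p x ⊢t ⊢u (tΓ x)

-- app_p records s + s' + 1, whereas size (app t u) puts the 1 in front.
app-tightlyTyped : ∀ {tt₁ tt₂ t u} →
  TightlyTyped tt₁ t → VrOrN tt₁ → TightlyTyped tt₂ u → VlOrN tt₂ →
  TightlyTyped n (app t u)
app-tightlyTyped {t = t} {u} (Γ , tΓ , ⊢t) vrn (Δ , tΔ , ⊢u) vln =
  _ , ⊕-tight tΓ tΔ ,
  subst (λ k → Γ ⊕ Δ ⊢[ + 0 , + 0 , + k ] app t u ∶ n)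
        (+-comm (size t +ℕ size u) 1)
        (app-p ⊢t vrn ⊢u vln)

mutual
  VrV⇒vr : ∀ {t} → VrV t → TightlyTyped vr t
  VrV⇒vr (vr-var x)       = _ , ∶∶-tight x (t-vr ∷ []) , var-p x
  VrV⇒vr (vr-es x vt neu) = es-tightlyTyped x (VrV⇒vr vt) (NeV⇒n neu)

  VrV⇒vl : ∀ {t} → VrV t → TightlyTyped vl t
  VrV⇒vl (vr-var x)       = _ , ∅-tight , val-p x
  VrV⇒vl (vr-es x vt neu) = es-tightlyTyped x (VrV⇒vl vt) (NeV⇒n neu)

  NeV⇒n : ∀ {t} → NeV t → TightlyTyped n t
  NeV⇒n (ne-vr vt nou) with NoV⇒vlOrN nou
  ... | _ , vln , ⊢u = app-tightlyTyped (VrV⇒vr vt) von-vr ⊢u vln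
  NeV⇒n (ne-ne net nou) with NoV⇒vlOrN nou
  ... | _ , vln , ⊢u = app-tightlyTyped (NeV⇒n net) von-n ⊢u vln
  NeV⇒n (ne-es x net neu) = es-tightlyTyped x (NeV⇒n net) (NeV⇒n neu)

  NoV⇒vlOrN : ∀ {t} → NoV t → Σ Ty (λ σ → VlOrN σ × TightlyTyped σ t)
  NoV⇒vlOrN (no-lam x t) = vl , vln-vl , _ , ∅-tight , abs-p x t
  NoV⇒vlOrN (no-vr vt)   = vl , vln-vl , VrV⇒vl vt
  NoV⇒vlOrN (no-ne net)  = n , vln-n , NeV⇒n net
  NoV⇒vlOrN (no-es x nov neu) with NoV⇒vlOrN nov
  ... | σ , vln , ⊢t = σ , vln , es-tightlyTyped x ⊢t (NeV⇒n neu)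

lemma4p9 : (t : Tm) → NoV t →
    Σ Ctx (λ Γ → Σ Ty (λ σ →
      TightCtx Γ × TightTy σ × (Γ ⊢[ + 0 , + 0 , + size t ] t ∶ σ)))
lemma4p9 t nov with NoV⇒vlOrN nov
... | σ , vln , Γ , tΓ , ⊢t = Γ , σ , tΓ , VlOrN⇒TightTy vln , ⊢t
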